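{- Let $D=(V,E)$ be a finite directed acyclic graph with a single sink $r$ such that every node of $D$ has a directed path to $r$. Let $C\subseteq E$ be a line cut of $D$, and let $(S,T)$ be the partition of $V$ induced by $C$: $T$ is the set of nodes from which $r$ is reachable in $D-C$, and $S=V\setminus T$. Then $C$ is a strong line cut if and only if the partition $(S,T)$ is unidirectional, i.e. no edge of $D$ has its tail in $T$ and its head in $S$ (so every edge joining the two parts goes from $S$ to $T$).
   Context: The edges of $D$ are called lines. The sources of $D$ (nodes with no incoming edges) are its primary inputs. A line cut of $D$ is an inclusion-minimal set $C$ of edges whose removal eliminates every directed path from a source of $D$ to the sink $r$. A line cut is strong if no two of its edges lie on a common directed path of $D$. $D-C$ denotes the graph obtained from $D$ by deleting the edges in $C$. -}

module Defs where

open import Data.Nat using (ℕ)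
open import Data.Fin using (Fin)
open import Data.Fin.Subset using (Subset; _∈_; _∉_; _⊂_)
open import Data.List using (List; []; _∷_)
open import Data.List.Membership.Propositional using () renaming (_∈_ to _∈ˡ_)
open import Data.Product using (Σ; ∃; _×_)
open import Relation.Binary.PropositionalEquality using (_≡_; _≢_)
open import Relation.Nullary using (¬_)

record Digraph : Set where
  field
    n    : ℕ
    m    : ℕ
    tail : Fin m → Fin n
    head : Fin m → Fin n

module _ (D : Digraph) where
  open Digraph D

  Node = Fin n
  Edge = Fin m

  -- A directed path from u to v, given by its list of edges
  -- (in a DAG every directed walk is a path).
  data Walk : Node → Node → List Edge → Set where
    []  : ∀ {u} → Walk u u []
    _∷_ : ∀ {u v e es} → tail e ≡ u → Walk (head e) v es → Walk u v (e ∷ es)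

  IsSource : Node → Set
  IsSource v = ∀ (e : Edge) → head e ≢ v

  IsSink : Node → Set
  IsSink v = ∀ (e : Edge) → tail e ≢ v

  Acyclic : Set
  Acyclic = ∀ (v : Node) (es : List Edge) → Walk v v es → es ≡ []

  IsRootedDAG : Node → Set
  IsRootedDAG r =
    Acyclic × IsSink r × (∀ v → IsSink v → v ≡ r)
    × (∀ v → ∃ λ es → Walk v r es)

  Separates : Node → Subset m → Set
  Separates r C = ∀ s es → IsSource s → Walk s r es → ∃ λ e → e ∈ˡ es × e ∈ C

  IsLineCut : Node → Subset m → Set
  IsLineCut r C = Separates r C × (∀ C' → C' ⊂ C → ¬ Separates r C')

  IsStrong : Subset m → Set
  IsStrong C = ∀ e₁ e₂ → e₁ ∈ C → e₂ ∈ C → e₁ ≢ e₂ →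
    ¬ (∃ λ u → ∃ λ v → ∃ λ es → Walk u v es × e₁ ∈ˡ es × e₂ ∈ˡ es)

  InT : Node → Subset m → Node → Set
  InT r C v = ∃ λ es → Walk v r es × (∀ e → e ∈ˡ es → e ∉ C)

  InS : Node → Subset m → Node → Set
  InS r C v = ¬ InT r C v

  Unidirectional : Node → Subset m → Set
  Unidirectional r C = ∀ (e : Edge) → ¬ (InT r C (tail e) × InS r C (head e))

-- Minimality of the cut puts the tail of every cut edge in S and its head in T:
-- otherwise the cut minus that edge would still separate the sources from r.
-- If no edge goes from T to S, a walk starting in T stays out of S, so no walk
-- leads from the head of one cut edge to the tail of another; hence no two cut
-- edges lie on a common path. Conversely, if e goes from T to S, a walk from a
-- source to tail e followed by a C-free walk to r must cross C at some g before e,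
-- and the walk from head e to r (head e being in S) crosses C at some f; then g
-- and f lie on the common path through e.
module Submission where

open import Defs
open import Data.Empty using (⊥-elim)
open import Data.Fin using (_≟_)
open import Data.Fin.Properties using (any?)
open import Data.Fin.Subset using (Subset; _∈_; _∉_; _⊂_; _-_; _∪_; ⁅_⁆; ∣_∣; ⊥)
open import Data.Fin.Subset.Properties
  using (_∈?_; p⊂q⇒∣p∣<∣q∣; p⊆p∪q; x∈p∪q⁺; x∈p∪q⁻; x∈⁅x⁆; x∈⁅y⁆⇒x≡y; ∣p∣≤n; ∉⊥; ∣⊥∣≡0;
         x∈p⇒p-x⊂p; x∈p∧x≢y⇒x∈p-y)
open import Data.List using (List; []; _∷_; _++_)
open import Data.List.Membership.Propositional using () renaming (_∈_ to _∈ˡ_)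
open import Data.List.Membership.Propositional.Properties using (∈-++⁺ˡ; ∈-++⁺ʳ; ∈-++⁻)
open import Data.List.Relation.Unary.Any using (here; there)
open import Data.Nat using (zero; suc; _+_; _<_; _≤_)
open import Data.Nat.Properties using (+-suc; +-monoˡ-≤; +-identityʳ; ≤-trans; ≤-reflexive; <⇒≱)
open import Data.Product using (∃; _×_; _,_; proj₁; proj₂)
open import Data.Sum using (_⊎_; inj₁; inj₂)
open import Function using (_∘_)
open import Function.Bundles using (_⇔_; mk⇔)
open import Relation.Nullary using (¬_; yes; no)
open import Relation.Binary.PropositionalEquality using (_≡_; _≢_; refl; sym; cong)

∣p∣<∣p∪⁅x⁆∣ : ∀ {k} {p : Subset k} {x} → x ∉ p → ∣ p ∣ < ∣ p ∪ ⁅ x ⁆ ∣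
∣p∣<∣p∪⁅x⁆∣ {x = x} x∉p = p⊂q⇒∣p∣<∣q∣ (p⊆p∪q ⁅ x ⁆ , x , x∈p∪q⁺ (inj₂ (x∈⁅x⁆ x)) , x∉p)

module Walks (D : Digraph) where
  open Digraph D

  Reaches : Node D → Node D → Set
  Reaches x y = ∃ λ es → Walk D x y es

  Avoids : Subset m → List (Edge D) → Set
  Avoids C es = ∀ e → e ∈ˡ es → e ∉ C

  _++ʷ_ : ∀ {x y z es fs} → Walk D x y es → Walk D y z fs → Walk D x z (es ++ fs)
  [] ++ʷ w = w
  (t ∷ v) ++ʷ w = t ∷ (v ++ʷ w)

  record Through (x y : Node D) (e : Edge D) (es : List (Edge D)) : Set where
    constructor through
    field
      {before after} : List (Edge D)
      prefix : Walk D x (tail e) before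
      suffix : Walk D (head e) y after
      splits : es ≡ before ++ e ∷ after

  open Through

  through-∈ : ∀ {x y e es} → Through x y e es → e ∈ˡ es
  through-∈ (through {before = bs} _ _ refl) = ∈-++⁺ʳ bs (here refl)

  before⊆ : ∀ {x y e es g} (t : Through x y e es) → g ∈ˡ before t → g ∈ˡ es
  before⊆ (through _ _ refl) = ∈-++⁺ˡ

  split-at : ∀ {x y e es} → Walk D x y es → e ∈ˡ es → Through x y e es
  split-at (refl ∷ w) (here refl) = through [] w refl
  split-at (refl ∷ w) (there e∈) with split-at w e∈
  ... | through pre suf refl = through (refl ∷ pre) suf refl

  ordered : ∀ {x y es e₁ e₂} → Walk D x y es → e₁ ∈ˡ es → e₂ ∈ˡ es → e₁ ≢ e₂ →
            Reaches (head e₁) (tail e₂) ⊎ Reaches (head e₂) (tail e₁)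
  ordered w e₁∈ e₂∈ e₁≢e₂ with split-at w e₁∈
  ... | through {before = bs} pre suf refl with ∈-++⁻ bs e₂∈
  ...   | inj₁ e₂∈bs        = inj₂ (_ , suffix (split-at pre e₂∈bs))
  ...   | inj₂ (here refl)  = ⊥-elim (e₁≢e₂ refl)
  ...   | inj₂ (there e₂∈cs) = inj₁ (_ , prefix (split-at suf e₂∈cs))

  LastEdgeIn : Subset m → Node D → Node D → List (Edge D) → Set
  LastEdgeIn C x y es = ∃ λ e → e ∈ C × ∃ λ (t : Through x y e es) → Avoids C (after t)

  last-edge-in : ∀ C {x y es} → Walk D x y es → Avoids C es ⊎ LastEdgeIn C x y es
  last-edge-in C [] = inj₁ λ _ ()
  last-edge-in C (_∷_ {e = e} refl w) with last-edge-in C w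
  ... | inj₂ (f , f∈C , through pre suf refl , avoid) =
    inj₂ (f , f∈C , through (refl ∷ pre) suf refl , avoid)
  ... | inj₁ avoid with e ∈? C
  ...   | yes e∈C = inj₂ (e , e∈C , through [] w refl , avoid)
  ...   | no  e∉C = inj₁ λ { _ (here refl) → e∉C ; g (there g∈) → avoid g g∈ }

  SourceReaches : Node D → Set
  SourceReaches v = ∃ λ s → IsSource D s × Reaches s v

  module _ (acyclic : Acyclic D) where
    ¬head↝tail : ∀ e → ¬ Reaches (head e) (tail e)
    ¬head↝tail e (es , w) with acyclic (tail e) (e ∷ es) (refl ∷ w)
    ... | ()

    ∉-walk-to-tail : ∀ {x e es} → Walk D x (tail e) es → ¬ e ∈ˡ es
    ∉-walk-to-tail w e∈ = ¬head↝tail _ (_ , suffix (split-at w e∈))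

    private
      ReachesAll : Node D → Subset n → Set
      ReachesAll v vis = ∀ {x} → x ∈ vis → Reaches v x

      add-self : ∀ {v vis} → ReachesAll v vis → ReachesAll v (vis ∪ ⁅ v ⁆)
      add-self {v} {vis} reach x∈ with x∈p∪q⁻ vis ⁅ v ⁆ x∈
      ... | inj₁ x∈vis = reach x∈vis
      ... | inj₂ x∈v rewrite x∈⁅y⁆⇒x≡y v x∈v = [] , []

      -- Backwards search: the visited nodes are reachable from the current one, so
      -- by acyclicity the current node is new and the visited set grows strictly.
      search : ∀ k v vis → v ∉ vis → ReachesAll v vis → n ≤ ∣ vis ∣ + k → SourceReaches v
      search zero v vis v∉ _ bound =
        ⊥-elim (<⇒≱ (∣p∣<∣p∪⁅x⁆∣ v∉) (≤-trans (∣p∣≤n (vis ∪ ⁅ v ⁆)) (≤-trans bound (≤-reflexive (+-identityʳ _)))))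
      search (suc k) v vis v∉ reach bound with any? (λ e → head e ≟ v)
      ... | no ¬entered = v , (λ e he → ¬entered (e , he)) , [] , []
      ... | yes (e , refl) with search k (tail e) (vis ∪ ⁅ head e ⁆)
                                  (¬head↝tail e ∘ add-self reach) (cons ∘ add-self reach)
                                  (≤-trans bound (≤-trans (≤-reflexive (+-suc _ k)) (+-monoˡ-≤ k (∣p∣<∣p∪⁅x⁆∣ v∉))))
        where
        cons : ∀ {x} → Reaches (head e) x → Reaches (tail e) x
        cons (es , w) = e ∷ es , refl ∷ w
      ...   | s , source , es , w = s , source , _ , w ++ʷ (refl ∷ [])

    source-reaches : ∀ v → SourceReaches v
    source-reaches v = search n v ⊥ ∉⊥ (⊥-elim ∘ ∉⊥) (≤-reflexive (cong (_+ n) (sym (∣⊥∣≡0 n))))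

module LineCut (D : Digraph) (r : Node D) (rooted : IsRootedDAG D r)
               (C : Subset (Digraph.m D)) (cut : IsLineCut D r C) where
  open Digraph D
  open Walks D
  open Through

  private
    acyclic : Acyclic D
    acyclic = proj₁ rooted

    separating : Separates D r C
    separating = proj₁ cut

    minimal : ∀ C′ → C′ ⊂ C → ¬ Separates D r C′
    minimal = proj₂ cut

    reaches-root : ∀ v → Reaches v r
    reaches-root = proj₂ (proj₂ (proj₂ rooted))

  cut-edge-needed : ∀ {c} → c ∈ C →
    ¬ (∀ {s as bs} → IsSource D s → Walk D s (tail c) as → Walk D (head c) r bs → Avoids C bs →
       ∃ λ g → g ∈ˡ as × g ∈ C × g ≢ c)
  cut-edge-needed {c} c∈C bypass = minimal (C - c) (x∈p⇒p-x⊂p c∈C) separates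
    where
    separates : Separates D r (C - c)
    separates s es source w with last-edge-in C w
    ... | inj₁ avoid with separating s es source w
    ...   | e , e∈es , e∈C = ⊥-elim (avoid e e∈es e∈C)
    separates s es source w | inj₂ (e , e∈C , t , avoid) with e ≟ c
    ... | no e≢c = e , through-∈ t , x∈p∧x≢y⇒x∈p-y e∈C e≢c
    ... | yes refl with bypass source (prefix t) (suffix t) avoid
    ...   | g , g∈ , g∈C , g≢c = g , before⊆ t g∈ , x∈p∧x≢y⇒x∈p-y g∈C g≢c

  head-∉S : ∀ {c} → c ∈ C → ¬ InS D r C (head c)
  head-∉S c∈C head∉T = cut-edge-needed c∈C λ _ _ suf avoid → ⊥-elim (head∉T (_ , suf , avoid))

  tail-∈S : ∀ {c} → c ∈ C → InS D r C (tail c)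
  tail-∈S {c} c∈C (_ , q , q-avoids) = cut-edge-needed c∈C bypass
    where
    bypass : ∀ {s as bs} → IsSource D s → Walk D s (tail c) as → Walk D (head c) r bs → Avoids C bs →
             ∃ λ g → g ∈ˡ as × g ∈ C × g ≢ c
    bypass {as = as} source pre _ _ with separating _ _ source (pre ++ʷ q)
    ... | g , g∈ , g∈C with ∈-++⁻ as g∈
    ...   | inj₁ g∈as = g , g∈as , g∈C , λ { refl → ∉-walk-to-tail acyclic pre g∈as }
    ...   | inj₂ g∈qs = ⊥-elim (q-avoids g g∈qs g∈C)

  unidirectional⇒¬S-downstream : Unidirectional D r C → ∀ {x y es} →
                                  Walk D x y es → InT D r C x → ¬ InS D r C y
  unidirectional⇒¬S-downstream uni []                     x∈T y∈S = y∈S x∈T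
  unidirectional⇒¬S-downstream uni (_∷_ {e = e} refl w) x∈T y∈S =
    uni e (x∈T , λ head∈T → unidirectional⇒¬S-downstream uni w head∈T y∈S)

  unidirectional⇒no-walk-between : Unidirectional D r C → ∀ {a b es} → a ∈ C → b ∈ C →
                                   ¬ Walk D (head a) (tail b) es
  unidirectional⇒no-walk-between uni a∈C b∈C w = head-∉S a∈C λ head∈T →
    unidirectional⇒¬S-downstream uni w head∈T (tail-∈S b∈C)

  unidirectional⇒strong : Unidirectional D r C → IsStrong D C
  unidirectional⇒strong uni e₁ e₂ e₁∈C e₂∈C e₁≢e₂ (_ , _ , _ , w , e₁∈ , e₂∈)
    with ordered w e₁∈ e₂∈ e₁≢e₂
  ... | inj₁ (_ , v) = unidirectional⇒no-walk-between uni e₁∈C e₂∈C v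
  ... | inj₂ (_ , v) = unidirectional⇒no-walk-between uni e₂∈C e₁∈C v

  strong⇒unidirectional : IsStrong D C → Unidirectional D r C
  strong⇒unidirectional strong e ((_ , q , q-avoids) , head∈S) with reaches-root (head e)
  ... | _ , w with last-edge-in C w
  ...   | inj₁ avoid = head∈S (_ , w , avoid)
  ...   | inj₂ (f , f∈C , through {before = as} pre _ _ , _) with source-reaches acyclic (tail e)
  ...     | s , source , ps , p with separating s _ source (p ++ʷ q)
  ...       | g , g∈ , g∈C with ∈-++⁻ ps g∈
  ...         | inj₂ g∈q  = q-avoids g g∈q g∈C
  ...         | inj₁ g∈ps =
    strong g f g∈C f∈C (λ { refl → ∉-walk-to-tail acyclic to-tail-f (∈-++⁺ˡ g∈ps) })
      (s , head f , _ , to-tail-f ++ʷ (refl ∷ []) , ∈-++⁺ˡ (∈-++⁺ˡ g∈ps) , ∈-++⁺ʳ (ps ++ e ∷ as) (here refl))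
    where
    to-tail-f : Walk D s (tail f) (ps ++ e ∷ as)
    to-tail-f = p ++ʷ (refl ∷ pre)

lemma2 : (D : Digraph) (r : Node D) → IsRootedDAG D r →
    (C : Subset (Digraph.m D)) → IsLineCut D r C →
    (IsStrong D C ⇔ Unidirectional D r C)
lemma2 D r rooted C cut = mk⇔ strong⇒unidirectional unidirectional⇒strong
  where open LineCut D r rooted C cut
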